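{- Let $\mathbf h=(h_1,\dots,h_n)$ be an integer vector and $\nu=(h_1,\dots,h_n,-\sum_kh_k)\in\mathbb R^{n+1}$. Under the natural bijection $\mathcal T(\mathbf h)\to A(\nu)$, the two-sided dictionary order on $A(\nu)$ refines the merge (Tesler) order on $\mathcal T(\mathbf h)$: if $B\le A$ in $\mathcal T(\mathbf h)$ then the corresponding Lusztig data satisfy the same inequality in the two-sided dictionary order.
   Context: $\mathcal T(\mathbf h)$ is the set of $n\times n$ upper-triangular matrices with nonnegative integer entries whose hook sums $\sum_{i=k}^na_{ki}-\sum_{i=1}^{k-1}a_{ik}$ equal $h_k$ for each $k$. The Tesler (merge) order on $\mathcal T(\mathbf h)$ is generated by covering relations $B\lessdot A$ where $A,B$ agree except either $a_{ij}=b_{ij}+1$, $a_{jk}=b_{jk}+1$, $a_{ik}=b_{ik}-1$ for a unique triple $i<j<k$, or $a_{ij}=b_{ij}+1$, $a_{jj}=b_{jj}+1$, $a_{ii}=b_{ii}-1$ for a unique pair $i<j$. With $\alpha_{ij}=e_i-e_{j+1}\in\mathbb R^{n+1}$, a Lusztig datum for $\nu$ is a tuple $(c_{11},c_{12},\dots,c_{1n},c_{22},\dots,c_{2n},\dots,c_{nn})\in\mathbb N^{\binom{n+1}{2}}$ (in this order, indexed linearly) with $\sum c_{ij}\alpha_{ij}=\nu$; $A(\nu)$ is their set. The two-sided dictionary order: $\mathbf a\le\mathbf a'$ if there exist indices $l\le r$ with $a'_l>a_l$, $a'_r>a_r$ and $a'_i=a_i$ for all $i<l$ and $i>r$. The natural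 bijection $\mathcal T(\mathbf h)\to A(\nu)$ sends $A=(a_{ij})$ to the datum with $c_{i,j-1}=a_{ij}$ for $i<j\le n$ and $c_{in}=a_{ii}$ (i.e. entry $a_{ij}$, $i<j$, gives $e_i-e_j$ and $a_{ii}$ gives $e_i-e_{n+1}$). -}

module Defs where

open import Data.Nat as ℕ using (ℕ; zero; suc)
open import Data.Integer as ℤ using (ℤ)
open import Data.Fin as F using (Fin; toℕ)
open import Data.Fin.Properties using (_≤?_; _<?_)
open import Data.List using (List; []; _∷_; map; filter; allFin; concatMap; length; _++_; [_])
open import Data.List as L using ()
open import Data.Product using (Σ; ∃; ∃-syntax; _×_; _,_)
open import Data.Sum using (_⊎_)
open import Relation.Binary.PropositionalEquality using (_≡_; _≢_)
open import Relation.Binary.Construct.Closure.ReflexiveTransitive using (Star)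

Matrix : ℕ → Set
Matrix n = Fin n → Fin n → ℕ

sumℕ : List ℕ → ℕ
sumℕ = Data.Nat.ListAction.sum
  where import Data.Nat.ListAction

UpperTriangular : ∀ {n} → Matrix n → Set
UpperTriangular {n} A = ∀ (i j : Fin n) → j F.< i → A i j ≡ 0

hookSum : ∀ {n} → Matrix n → Fin n → ℤ
hookSum {n} A k =
  ℤ.+ (sumℕ (map (λ i → A k i) (filter (k ≤?_) (allFin n))))
  ℤ.- ℤ.+ (sumℕ (map (λ i → A i k) (filter (_<? k) (allFin n))))

InT : ∀ {n} → (Fin n → ℤ) → Matrix n → Set
InT {n} h A = UpperTriangular A × (∀ k → hookSum A k ≡ h k)

TripleMove : ∀ {n} → Matrix n → Matrix n → Set
TripleMove {n} B A =
  Σ (Fin n) λ i → Σ (Fin n) λ j → Σ (Fin n) λ k →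
    i F.< j × j F.< k ×
    A i j ≡ suc (B i j) × A j k ≡ suc (B j k) × B i k ≡ suc (A i k) ×
    (∀ p q → (p ≡ i × q ≡ j → Data.Empty.⊥) → (p ≡ j × q ≡ k → Data.Empty.⊥) →
             (p ≡ i × q ≡ k → Data.Empty.⊥) → A p q ≡ B p q)
  where import Data.Empty

PairMove : ∀ {n} → Matrix n → Matrix n → Set
PairMove {n} B A =
  Σ (Fin n) λ i → Σ (Fin n) λ j →
    i F.< j ×
    A i j ≡ suc (B i j) × A j j ≡ suc (B j j) × B i i ≡ suc (A i i) ×
    (∀ p q → (p ≡ i × q ≡ j → Data.Empty.⊥) → (p ≡ j × q ≡ j → Data.Empty.⊥) →
             (p ≡ i × q ≡ i → Data.Empty.⊥) → A p q ≡ B p q)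
  where import Data.Empty

Cover : ∀ {n} → Matrix n → Matrix n → Set
Cover B A = TripleMove B A ⊎ PairMove B A

CoverIn : ∀ {n} → (Fin n → ℤ) → Matrix n → Matrix n → Set
CoverIn h B A = InT h B × InT h A × Cover B A

TeslerLe : ∀ {n} → (Fin n → ℤ) → Matrix n → Matrix n → Set
TeslerLe h B A = Star (CoverIn h) B A

-- Natural bijection 𝒯(h) → A(ν): linear order (c_11,…,c_1n,c_22,…,c_2n,…,c_nn),
-- with c_{i,j-1} = a_{ij} (i<j) and c_{in} = a_{ii}.
lusztigDatum : ∀ {n} → Matrix n → List ℕ
lusztigDatum {n} A =
  concatMap (λ i → map (λ j → A i j) (filter (i <?_) (allFin n)) ++ [ A i i ])
            (allFin n)

-- total lookup (position in 0-based linear index; 0 outside the list, never used in range)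
at : List ℕ → ℕ → ℕ
at []       _       = 0
at (x ∷ xs) zero    = x
at (x ∷ xs) (suc i) = at xs i

TwoSidedLt : List ℕ → List ℕ → Set
TwoSidedLt a a' =
  length a ≡ length a' ×
  ∃[ l ] ∃[ r ] (l ℕ.≤ r × r ℕ.< length a ×
    at a l ℕ.< at a' l × at a r ℕ.< at a' r ×
    (∀ i → i ℕ.< l → at a' i ≡ at a i) ×
    (∀ i → r ℕ.< i → i ℕ.< length a → at a' i ≡ at a i))

TwoSidedLe : List ℕ → List ℕ → Set
TwoSidedLe a a' = a ≡ a' ⊎ TwoSidedLt a a'

{-# OPTIONS --safe #-}
-- Read the Lusztig datum of a matrix row by row, each row ending with its
-- diagonal entry.  A cover changes exactly three entries, and in this reading
-- order the first and the last of them go up (a_ij and a_jk, resp. a_ij and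
-- a_jj) while the middle one (a_ik, resp. a_ii) goes down.  So every cover
-- increases the datum both lexicographically and colexicographically; both
-- orders are transitive, so every chain of covers does too, and the first
-- and last differing positions then witness the two-sided dictionary order.
module Submission where

open import Defs
open import Data.Nat using (ℕ)
open import Data.Integer using (ℤ)
open import Data.Fin using (Fin)

open import Level using (Level; _⊔_; 0ℓ)
open import Function using (_∘_; id)
open import Data.Nat using (zero; suc; z≤n; s≤s; _<_; _≤_)
import Data.Nat.Properties as ℕ
import Data.Fin as F
import Data.Fin.Properties as F
open import Data.Product using (_×_; _,_; proj₁; ∃-syntax)
open import Data.Sum as Sum using (_⊎_; inj₁; inj₂)
open import Data.List using (List; []; _∷_; map; filter; allFin; concatMap; length; _++_; [_])
open import Data.List.Properties using (map-++; map-∘; map-cong-local; concatMap-cong; map-concatMap)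
open import Data.List.Membership.Propositional using (_∈_; lose)
open import Data.List.Membership.Propositional.Properties
  using (∈-allFin; ∈-filter⁺; ∈-map⁺; ∈-++⁺ˡ; ∈-++⁺ʳ; ∈-concatMap⁺)
open import Data.List.Relation.Unary.Any using (here; there)
open import Data.List.Relation.Unary.All as All using (All; []; _∷_)
import Data.List.Relation.Unary.All.Properties as All
open import Data.List.Relation.Unary.AllPairs as AllPairs using (AllPairs; []; _∷_)
import Data.List.Relation.Unary.AllPairs.Properties as AllPairs
open import Data.List.Relation.Binary.Lex.Strict using (Lex-<; halt; this; next; <-transitive)
open import Data.Empty using (⊥-elim)
open import Relation.Nullary using (¬_)
open import Relation.Binary using (Rel; Transitive)
open import Relation.Binary.PropositionalEquality
  using (_≡_; _≢_; refl; sym; cong; subst₂; isEquivalence; module ≡-Reasoning)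
open import Relation.Binary.Construct.Closure.ReflexiveTransitive using (Star; ε; _◅_; gmap)

private
  variable
    a ℓ : Level
    X : Set a

data Colex {X : Set a} (_≺_ : Rel X ℓ) : Rel (List X) (a ⊔ ℓ) where
  head< : ∀ {x y xs ys} → x ≺ y → xs ≡ ys → Colex _≺_ (x ∷ xs) (y ∷ ys)
  tail< : ∀ {x y xs ys} → Colex _≺_ xs ys → Colex _≺_ (x ∷ xs) (y ∷ ys)

module _ {_≺_ : Rel X ℓ} where

  Colex-trans : Transitive _≺_ → Transitive (Colex _≺_)
  Colex-trans ≺-trans (head< x≺y refl) (head< y≺z refl) = head< (≺-trans x≺y y≺z) refl
  Colex-trans ≺-trans (head< _ refl)   (tail< ys<zs)    = tail< ys<zs
  Colex-trans ≺-trans (tail< xs<ys)    (head< _ refl)   = tail< xs<ys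
  Colex-trans ≺-trans (tail< xs<ys)    (tail< ys<zs)    = tail< (Colex-trans ≺-trans xs<ys ys<zs)

  Colex⇒length≡ : ∀ {xs ys} → Colex _≺_ xs ys → length xs ≡ length ys
  Colex⇒length≡ (head< _ refl) = refl
  Colex⇒length≡ (tail< xs<ys)  = cong suc (Colex⇒length≡ xs<ys)

LexColex : Rel (List ℕ) _
LexColex xs ys = Lex-< _≡_ _<_ xs ys × Colex _<_ xs ys

LexColex-trans : Transitive LexColex
LexColex-trans (lex₁ , colex₁) (lex₂ , colex₂) =
  <-transitive isEquivalence ℕ.<-resp₂-≡ ℕ.<-trans lex₁ lex₂ ,
  Colex-trans ℕ.<-trans colex₁ colex₂

Lex⇒firstDifference : ∀ {xs ys} → length xs ≡ length ys → Lex-< _≡_ _<_ xs ys →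
  ∃[ l ] (l < length xs × at xs l < at ys l × (∀ i → i < l → at ys i ≡ at xs i))
Lex⇒firstDifference () halt
Lex⇒firstDifference _ (this x<y) = 0 , s≤s z≤n , x<y , λ _ ()
Lex⇒firstDifference len≡ (next refl xs<ys)
  with l , l<len , differ , agree ← Lex⇒firstDifference (ℕ.suc-injective len≡) xs<ys =
  suc l , s≤s l<len , differ , λ { zero _ → refl ; (suc i) (s≤s i<l) → agree i i<l }

Colex⇒lastDifference : ∀ {xs ys} → Colex _<_ xs ys →
  ∃[ r ] (r < length xs × at xs r < at ys r ×
          (∀ i → r < i → i < length xs → at ys i ≡ at xs i))
Colex⇒lastDifference (head< x<y refl) = 0 , s≤s z≤n , x<y , λ { (suc i) _ _ → refl }
Colex⇒lastDifference (tail< xs<ys)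
  with r , r<len , differ , agree ← Colex⇒lastDifference xs<ys =
  suc r , s≤s r<len , differ , λ { (suc i) (s≤s r<i) (s≤s i<len) → agree i r<i i<len }

LexColex⇒TwoSidedLt : ∀ {xs ys} → LexColex xs ys → TwoSidedLt xs ys
LexColex⇒TwoSidedLt (lex , colex)
  with l , _ , differˡ , agreeˡ ← Lex⇒firstDifference (Colex⇒length≡ colex) lex
     | r , r<len , differʳ , agreeʳ ← Colex⇒lastDifference colex =
  Colex⇒length≡ colex , l , r , l≤r , r<len , differˡ , differʳ , agreeˡ , agreeʳ
  where
  l≤r : l ≤ r
  l≤r = ℕ.≮⇒≥ (λ r<l → ℕ.<-irrefl (sym (agreeˡ r r<l)) differʳ)

Star⇒≡⊎ : {R : Rel X ℓ} → Transitive R → ∀ {x y} → Star R x y → x ≡ y ⊎ R x y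
Star⇒≡⊎ R-trans ε = inj₁ refl
Star⇒≡⊎ R-trans (xRy ◅ yR*z) with Star⇒≡⊎ R-trans yR*z
... | inj₁ refl = inj₂ xRy
... | inj₂ yRz  = inj₂ (R-trans xRy yRz)

AllPairs-zipWithAll : ∀ {P : X → Set ℓ} {R S : Rel X ℓ} → (∀ {x y} → P x → R x y → S x y) →
  ∀ {xs} → All P xs → AllPairs R xs → AllPairs S xs
AllPairs-zipWithAll f []         []         = []
AllPairs-zipWithAll f (px ∷ pxs) (rx ∷ rxs) = All.map (f px) rx ∷ AllPairs-zipWithAll f pxs rxs

module _ {_⊏_ : Rel X ℓ} (f g : X → ℕ) where

  map-Lex : ∀ {xs x} → AllPairs _⊏_ xs → x ∈ xs → f x < g x →
    (∀ {y} → y ⊏ x → f y ≡ g y) → Lex-< _≡_ _<_ (map f xs) (map g xs)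
  map-Lex (_ ∷ _) (here refl) fx<gx _ = this fx<gx
  map-Lex (y⊏ ∷ sorted) (there x∈) fx<gx agree =
    next (agree (All.lookup y⊏ x∈)) (map-Lex sorted x∈ fx<gx agree)

  map-Colex : ∀ {xs x} → AllPairs _⊏_ xs → x ∈ xs → f x < g x →
    (∀ {y} → x ⊏ y → f y ≡ g y) → Colex _<_ (map f xs) (map g xs)
  map-Colex (x⊏ ∷ _) (here refl) fx<gx agree = head< fx<gx (map-cong-local (All.map agree x⊏))
  map-Colex (_ ∷ sorted) (there x∈) fx<gx agree = tail< (map-Colex sorted x∈ fx<gx agree)

  -- Nothing is assumed about the entry at q: lying strictly between p and s,
  -- it affects neither comparison.
  outerRaise⇒LexColex : Transitive _⊏_ → (∀ {x} → ¬ x ⊏ x) →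
    ∀ {xs p q s} → AllPairs _⊏_ xs → p ∈ xs → s ∈ xs → p ⊏ q → q ⊏ s →
    f p < g p → f s < g s → (∀ x → x ≢ p → x ≢ q → x ≢ s → f x ≡ g x) →
    LexColex (map f xs) (map g xs)
  outerRaise⇒LexColex ⊏-trans ⊏-irrefl sorted p∈ s∈ p⊏q q⊏s raised-p raised-s fixed =
    map-Lex sorted p∈ raised-p before-p , map-Colex sorted s∈ raised-s after-s
    where
    before-p : ∀ {y} → y ⊏ _ → f y ≡ g y
    before-p y⊏p = fixed _ (λ { refl → ⊏-irrefl y⊏p })
                           (λ { refl → ⊏-irrefl (⊏-trans p⊏q y⊏p) })
                           (λ { refl → ⊏-irrefl (⊏-trans (⊏-trans p⊏q q⊏s) y⊏p) })
    after-s : ∀ {y} → _ ⊏ y → f y ≡ g y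
    after-s s⊏y = fixed _ (λ { refl → ⊏-irrefl (⊏-trans (⊏-trans p⊏q q⊏s) s⊏y) })
                          (λ { refl → ⊏-irrefl (⊏-trans q⊏s s⊏y) })
                          (λ { refl → ⊏-irrefl s⊏y })

module _ {n : ℕ} where

  Position : Set
  Position = Fin n × Fin n

  entry : Matrix n → Position → ℕ
  entry M (i , j) = M i j

  rowPositions : Fin n → List Position
  rowPositions i = map (i ,_) (filter (i F.<?_) (allFin n)) ++ [ (i , i) ]

  readingOrder : List Position
  readingOrder = concatMap rowPositions (allFin n)

  lusztigDatum≡map-entry : (M : Matrix n) → lusztigDatum M ≡ map (entry M) readingOrder
  lusztigDatum≡map-entry M = begin
    lusztigDatum M
      ≡⟨ concatMap-cong row (allFin n) ⟩
    concatMap (map (entry M) ∘ rowPositions) (allFin n)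
      ≡⟨ map-concatMap (entry M) rowPositions (allFin n) ⟨
    map (entry M) readingOrder
      ∎
    where
    open ≡-Reasoning
    row : ∀ i → map (M i) (filter (i F.<?_) (allFin n)) ++ [ M i i ] ≡ map (entry M) (rowPositions i)
    row i = begin
      map (M i) (filter (i F.<?_) (allFin n)) ++ [ M i i ]
        ≡⟨ cong (_++ [ M i i ]) (map-∘ (filter (i F.<?_) (allFin n))) ⟩
      map (entry M) (map (i ,_) (filter (i F.<?_) (allFin n))) ++ map (entry M) [ (i , i) ]
        ≡⟨ map-++ (entry M) (map (i ,_) (filter (i F.<?_) (allFin n))) [ (i , i) ] ⟨
      map (entry M) (rowPositions i)
        ∎

  infix 4 _⊏_
  data _⊏_ : Rel Position 0ℓ where
    row< : ∀ {i i′ j j′} → i F.< i′ → (i , j) ⊏ (i′ , j′)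
    col< : ∀ {i j j′} → i F.< j → j F.< j′ → (i , j) ⊏ (i , j′)
    diag : ∀ {i j} → i F.< j → (i , j) ⊏ (i , i)

  ⊏-irrefl : ∀ {p} → ¬ p ⊏ p
  ⊏-irrefl (row< i<i)   = F.<-irrefl refl i<i
  ⊏-irrefl (col< _ j<j) = F.<-irrefl refl j<j
  ⊏-irrefl (diag i<i)   = F.<-irrefl refl i<i

  ⊏-trans : Transitive _⊏_
  ⊏-trans (row< i<i′)    (row< i′<i″)    = row< (F.<-trans i<i′ i′<i″)
  ⊏-trans (row< i<i′)    (col< _ _)      = row< i<i′
  ⊏-trans (row< i<i′)    (diag _)        = row< i<i′
  ⊏-trans (col< _ _)     (row< i<i′)     = row< i<i′
  ⊏-trans (col< i<j j<k) (col< _ k<l)    = col< i<j (F.<-trans j<k k<l)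
  ⊏-trans (col< i<j _)   (diag _)        = diag i<j
  ⊏-trans (diag _)       (row< i<i′)     = row< i<i′
  ⊏-trans (diag _)       (col< i<i _)    = ⊥-elim (F.<-irrefl refl i<i)
  ⊏-trans (diag _)       (diag i<i)      = ⊥-elim (F.<-irrefl refl i<i)

  rowPositions-inRow : ∀ i → All ((_≡ i) ∘ proj₁) (rowPositions i)
  rowPositions-inRow i = All.++⁺ (All.map⁺ (All.universal (λ _ → refl) _)) (refl ∷ [])

  rowPositions-sorted : ∀ i → AllPairs _⊏_ (rowPositions i)
  rowPositions-sorted i =
    AllPairs.++⁺ (AllPairs.map⁺ (AllPairs-zipWithAll col< aboveDiagonal increasing))
                 ([] ∷ [])
                 (All.map⁺ (All.map (λ i<j → diag i<j ∷ []) aboveDiagonal))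
    where
    aboveDiagonal : All (i F.<_) (filter (i F.<?_) (allFin n))
    aboveDiagonal = All.all-filter (i F.<?_) (allFin n)
    increasing : AllPairs F._<_ (filter (i F.<?_) (allFin n))
    increasing = AllPairs.filter⁺ (i F.<?_) (AllPairs.tabulate⁺-< id)

  readingOrder-sorted : AllPairs _⊏_ readingOrder
  readingOrder-sorted =
    AllPairs.concat⁺ (All.map⁺ (All.universal rowPositions-sorted (allFin n)))
                     (AllPairs.map⁺ (AllPairs.map earlierRow (AllPairs.tabulate⁺-< id)))
    where
    earlierRow : ∀ {i i′} → i F.< i′ → All (λ p → All (p ⊏_) (rowPositions i′)) (rowPositions i)
    earlierRow {i} {i′} i<i′ =
      All.map (λ { {_ , _} refl →
                 All.map (λ { {_ , _} refl → row< i<i′ }) (rowPositions-inRow i′) })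
              (rowPositions-inRow i)

  aboveDiagonal∈readingOrder : ∀ {i j} → i F.< j → (i , j) ∈ readingOrder
  aboveDiagonal∈readingOrder {i} {j} i<j =
    ∈-concatMap⁺ rowPositions
      (lose (∈-allFin i) (∈-++⁺ˡ (∈-map⁺ (i ,_) (∈-filter⁺ (i F.<?_) (∈-allFin j) i<j))))

  diagonal∈readingOrder : ∀ i → (i , i) ∈ readingOrder
  diagonal∈readingOrder i =
    ∈-concatMap⁺ rowPositions (lose (∈-allFin i) (∈-++⁺ʳ _ (here refl)))

  split≢ : ∀ {p q i j : Fin n} → (p , q) ≢ (i , j) → ¬ (p ≡ i × q ≡ j)
  split≢ p,q≢i,j (refl , refl) = p,q≢i,j refl

  cover⇒entryLexColex : ∀ {A B} → Cover B A →
    LexColex (map (entry B) readingOrder) (map (entry A) readingOrder)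
  cover⇒entryLexColex {A} {B} (inj₁ (i , j , k , i<j , j<k , raised-ij , raised-jk , _ , fixed)) =
    outerRaise⇒LexColex (entry B) (entry A) ⊏-trans ⊏-irrefl readingOrder-sorted
      (aboveDiagonal∈readingOrder i<j) (aboveDiagonal∈readingOrder j<k)
      (col< i<j j<k) (row< i<j) (ℕ.≤-reflexive (sym raised-ij)) (ℕ.≤-reflexive (sym raised-jk))
      (λ { (p , q) ≢ij ≢ik ≢jk → sym (fixed p q (split≢ ≢ij) (split≢ ≢jk) (split≢ ≢ik)) })
  cover⇒entryLexColex {A} {B} (inj₂ (i , j , i<j , raised-ij , raised-jj , _ , fixed)) =
    outerRaise⇒LexColex (entry B) (entry A) ⊏-trans ⊏-irrefl readingOrder-sorted
      (aboveDiagonal∈readingOrder i<j) (diagonal∈readingOrder j)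
      (diag i<j) (row< i<j) (ℕ.≤-reflexive (sym raised-ij)) (ℕ.≤-reflexive (sym raised-jj))
      (λ { (p , q) ≢ij ≢ii ≢jj → sym (fixed p q (split≢ ≢ij) (split≢ ≢jj) (split≢ ≢ii)) })

  cover⇒LexColex : ∀ {A B} → Cover B A → LexColex (lusztigDatum B) (lusztigDatum A)
  cover⇒LexColex {A} {B} B⋖A =
    subst₂ LexColex (sym (lusztigDatum≡map-entry B)) (sym (lusztigDatum≡map-entry A))
      (cover⇒entryLexColex B⋖A)

corollary3p7 : (n : ℕ) (h : Fin n → ℤ) (A B : Matrix n) →
    InT h A → InT h B → TeslerLe h B A →
    TwoSidedLe (lusztigDatum B) (lusztigDatum A)
corollary3p7 n h A B _ _ B≤A =
  Sum.map₂ LexColex⇒TwoSidedLt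
    (Star⇒≡⊎ {R = LexColex} LexColex-trans
      (gmap lusztigDatum (λ (_ , _ , B⋖A) → cover⇒LexColex B⋖A) B≤A))
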